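{- Let $H'=(V,E)$ be a $3$-uniform hypergraph in which every vertex has degree at most $\Delta$, let $k$ be an integer and $d>0$, and suppose $H'$ contains a set of $k$ vertices inducing a subhypergraph of average degree $d'\ge c\,d$ for an absolute constant $c>0$. Consider the following algorithm. For each vertex $v\in V$, let $G_v$ be the graph on $V\setminus\{v\}$ with edge set $\{\{u,x\}: \{v,u,x\}\in E\}$. For each integer $\hat d\in\{1,\dots,k-1\}$, let $G_v^{\hat d}$ be obtained from $G_v$ by repeatedly deleting a vertex of degree less than $\hat d$ while one exists; let $S_v^{\hat d}$ be a set of $(k-1)/2$ vertices of highest degree in $G_v^{\hat d}$, and let $T_v^{\hat d}$ be a set of $(k-1)/2$ vertices with the most neighbors in $S_v^{\hat d}$ (in $G_v^{\hat d}$). Return the densest among the subhypergraphs $H'[\{v\}\cup S_v^{\hat d}\cup T_v^{\hat d}]$ over all choices of $v,\hat d$. Then the algorithm returns a $k$-subhypergraph with average degree $\Omega(d^2/(\Delta k))$ (i.e. containing $\Omega(d^2/\Delta)$ hyperedges), where the constant depends only on $c$.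
   Context: A $3$-uniform hypergraph has a finite vertex set and a collection of $3$-element subsets (hyperedges); the degree of a vertex is the number of hyperedges containing it. For $W\subseteq V$, $H'[W]$ is the subhypergraph induced by $W$, whose hyperedges are those contained in $W$. The average degree of a $k$-vertex subhypergraph with $q$ hyperedges is $3q/k$; "densest" means containing the most hyperedges.
   Formalization: The absolute constant c and the parameter d are taken to be positive rationals. -}

module Defs where

open import Data.Nat using (ℕ; _≤_; _<_; _⊓_; _/_; _∸_)
open import Data.Fin using (Fin; _≟_)
open import Data.Fin.Subset using (Subset; _∈_; _∉_; _⊆_; ∣_∣; ⁅_⁆; ∁; _∪_; _-_)
open import Data.Fin.Subset.Properties using (_∈?_; _⊆?_)
open import Data.List using (List; length; filter; allFin)
open import Data.List.Relation.Unary.All using (All)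
open import Data.List.Relation.Unary.Any using (Any; any?)
open import Data.List.Relation.Unary.Unique.Propositional using (Unique)
open import Data.Product using (Σ; ∃; ∃-syntax; _×_)
open import Data.Integer using (+_)
open import Data.Rational using (ℚ) renaming (_/_ to _/ℚ_)
open import Relation.Binary.PropositionalEquality using (_≡_; _≢_)
open import Relation.Binary.Construct.Closure.ReflexiveTransitive using (Star)
open import Relation.Nullary using (¬?)
open import Relation.Nullary.Decidable using (_×-dec_)

toℚ : ℕ → ℚ
toℚ m = (+ m) /ℚ 1

record Hypergraph (n : ℕ) : Set where
  field
    edges    : List (Subset n)
    uniform  : All (λ e → ∣ e ∣ ≡ 3) edges
    distinct : Unique edges
open Hypergraph public

degree : ∀ {n} → Hypergraph n → Fin n → ℕ
degree H v = length (filter (v ∈?_) (edges H))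

inducedEdges : ∀ {n} → Hypergraph n → Subset n → ℕ
inducedEdges H W = length (filter (_⊆? W) (edges H))

-- the link graph G_v on V ∖ {v}: {u,x} is an edge iff {v,u,x} ∈ E
-- (u, x, v pairwise distinct and some hyperedge contains all three;
--  since hyperedges have exactly 3 elements this hyperedge is {v,u,x})
Gadj : ∀ {n} → Hypergraph n → Fin n → Fin n → Fin n → Set
Gadj H v u x = (u ≢ x) × (u ≢ v) × (x ≢ v) × Any (λ e → (v ∈ e) × (u ∈ e) × (x ∈ e)) (edges H)

Gadj? : ∀ {n} (H : Hypergraph n) v u x → Relation.Nullary.Dec (Gadj H v u x)
Gadj? H v u x = ¬? (u ≟ x) ×-dec (¬? (u ≟ v) ×-dec (¬? (x ≟ v) ×-dec
                  any? (λ e → (v ∈? e) ×-dec ((u ∈? e) ×-dec (x ∈? e))) (edges H)))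

nbrsIn : ∀ {n} → Hypergraph n → Fin n → Subset n → Fin n → ℕ
nbrsIn {n} H v S u = length (filter (λ x → (x ∈? S) ×-dec Gadj? H v u x) (allFin n))

gdeg : ∀ {n} → Hypergraph n → Fin n → Subset n → Fin n → ℕ
gdeg = nbrsIn

PeelStep : ∀ {n} → Hypergraph n → Fin n → ℕ → Subset n → Subset n → Set
PeelStep H v dh W W' = ∃[ u ] (u ∈ W) × (gdeg H v W u < dh) × (W' ≡ W - u)

IsPeeled : ∀ {n} → Hypergraph n → Fin n → ℕ → Subset n → Set
IsPeeled H v dh C =
  Star (PeelStep H v dh) (∁ ⁅ v ⁆) C × (∀ u → u ∈ C → dh ≤ gdeg H v C u)

half : ℕ → ℕ
half k = (k ∸ 1) / 2

record Choice {n} (H : Hypergraph n) (k : ℕ) (v : Fin n) (dh : ℕ) : Set where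
  field
    core    : Subset n
    peeled  : IsPeeled H v dh core
    S       : Subset n
    S⊆      : S ⊆ core
    S-size  : ∣ S ∣ ≡ half k ⊓ ∣ core ∣
    S-top   : ∀ s u → s ∈ S → u ∈ core → u ∉ S → gdeg H v core u ≤ gdeg H v core s
    T       : Subset n
    T⊆      : T ⊆ core
    T-size  : ∣ T ∣ ≡ half k ⊓ ∣ core ∣
    T-top   : ∀ t u → t ∈ T → u ∈ core → u ∉ T → nbrsIn H v S u ≤ nbrsIn H v S t

output : ∀ {n} {H : Hypergraph n} {k v dh} → Choice H k v dh → Subset n
output {v = v} ch = ⁅ v ⁆ ∪ (Choice.S ch ∪ Choice.T ch)

-- Let v be a vertex of maximum degree D in H[W]; then D ≥ 3e(W)/k ≥ cd. The link graph G_v has at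
-- least 2D ordered adjacent pairs inside W − v. Peeling at threshold d̂ = ⌊D / 2(k−1)⌋ + 1 deletes at
-- most k − 1 vertices of W − v, each costing at most 2(d̂ − 1) pairs, so the core keeps at least D
-- pairs; its minimum degree is d̂, and it has at most 2Δ pairs since every pair extends to a hyperedge
-- through v. If the core has at most (k−1)/2 vertices then S is the whole core and the S–T pairs number
-- at least D; otherwise two averaging steps give at least (|S| d̂)² / 2Δ of them. Every S–T pair spans a
-- hyperedge {v, s, t} of the output, so in both cases D² ≤ 256 e(output) Δ, and C = c²/256 works.

module Submission where

open import Defs

module Combinatorics where

  open import Data.Nat using (ℕ; zero; suc; _+_; _*_; _≤_; _<_; z≤n; s≤s; _/_; _%_; NonZero; >-nonZero)
  open import Data.Nat.DivMod using (m≡m%n+[m/n]*n; m/n*n≤m; m%n<n; m≥n⇒m/n>0)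
  open import Data.Nat.Tactic.RingSolver using (solve-∀)
  open import Data.Nat.Properties hiding (_≟_)
  open import Algebra.Properties.CommutativeMonoid.Sum +-0-commutativeMonoid
    using (sum; sum-syntax; sum-cong-≗; sum-replicate-zero; ∑-distrib-+; ∑-comm)
  open import Algebra.Properties.Semiring.Sum +-*-semiring
    using (*-distribˡ-sum; *-distribʳ-sum)
  open import Data.Fin using (Fin; zero; suc; _≟_)
  open import Data.Fin.Properties using () renaming (suc-injective to fsuc-injective)
  open import Data.Fin.Subset using (Subset; inside; outside; _∈_; _∉_; _⊆_; ∣_∣; _-_; _─_; ⁅_⁆; _∩_; ∁; ⊤)
  open import Data.Fin.Subset.Properties
    using (_∈?_; _⊆?_; drop-there; p─q⊆p; x∈⁅x⁆; x∈p∧x≢y⇒x∈p-y; ⊆-antisym;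
           x∈p∩q⁺; x∈p∩q⁻; p∩q⊆p; x∈p∪q⁺; ∈⊤; x∉p⇒x∈∁p; x≢y⇒x∉⁅y⁆)
  open import Data.Vec using ([]; _∷_; here; there)
  open import Data.List using (List; []; _∷_; length; filter; tabulate; allFin)
  open import Data.List.Relation.Unary.All as All using (All; []; _∷_)
  open import Data.List.Relation.Unary.All.Properties using (all-filter)
  open import Data.List.Membership.Propositional.Properties using (∈-filter⁺; ∈-allFin)
  open import Data.List.Extrema ≤-totalOrder using (argmax; argmax-all; f[xs]≤f[argmax])
  open import Data.Unit using (tt)
  open import Data.List.Relation.Unary.Any as Any using (Any; here; there)
  open import Data.List.Relation.Unary.AllPairs using (AllPairs; []; _∷_)
  open import Data.Product using (Σ; ∃; ∃-syntax; _×_; _,_; proj₁; proj₂)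
  open import Data.Sum using (_⊎_; inj₁; inj₂)
  open import Function using (_∘_)
  open import Data.Empty using (⊥-elim)
  open import Relation.Nullary using (Dec; yes; no; ¬_; ¬?)
  open import Relation.Nullary.Decidable using (_×-dec_)
  open import Relation.Binary.PropositionalEquality
  import Algebra.Properties.CommutativeSemigroup +-commutativeSemigroup as +
  import Algebra.Properties.CommutativeSemigroup *-commutativeSemigroup as *
  open import Relation.Binary.Construct.Closure.ReflexiveTransitive using (Star; ε; _◅_)

  𝟙 : ∀ {ℓ} {P : Set ℓ} → Dec P → ℕ
  𝟙 (yes _) = 1
  𝟙 (no _)  = 0

  𝟙-yes : ∀ {ℓ} {P : Set ℓ} (d : Dec P) → P → 𝟙 d ≡ 1
  𝟙-yes (yes _) _  = refl
  𝟙-yes (no ¬p) p = ⊥-elim (¬p p)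

  𝟙-no : ∀ {ℓ} {P : Set ℓ} (d : Dec P) → ¬ P → 𝟙 d ≡ 0
  𝟙-no (yes p) ¬p = ⊥-elim (¬p p)
  𝟙-no (no _)  _  = refl

  𝟙*-positive : ∀ {ℓ} {P : Set ℓ} (d : Dec P) (x : ℕ) → 1 ≤ 𝟙 d * x → P
  𝟙*-positive (yes p) _ _ = p

  𝟙*≤ : ∀ {ℓ} {P : Set ℓ} (d : Dec P) (x : ℕ) → 𝟙 d * x ≤ x
  𝟙*≤ (yes _) x = ≤-reflexive (+-identityʳ x)
  𝟙*≤ (no _)  x = z≤n

  𝟙*-mono : ∀ {ℓ} {P : Set ℓ} (d : Dec P) {x y : ℕ} → (P → x ≤ y) → 𝟙 d * x ≤ 𝟙 d * y
  𝟙*-mono (yes p) x≤y = +-monoˡ-≤ 0 (x≤y p)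
  𝟙*-mono (no _)  _   = z≤n

  𝟙-mono : ∀ {ℓ ℓ′} {P : Set ℓ} {Q : Set ℓ′} (d : Dec P) (e : Dec Q) → (P → Q) → 𝟙 d ≤ 𝟙 e
  𝟙-mono (yes p) e       f = ≤-reflexive (sym (𝟙-yes e (f p)))
  𝟙-mono (no _)  _       _ = z≤n

  𝟙-cong : ∀ {ℓ ℓ′} {P : Set ℓ} {Q : Set ℓ′} (d : Dec P) (e : Dec Q) → (P → Q) → (Q → P) → 𝟙 d ≡ 𝟙 e
  𝟙-cong d e f g = ≤-antisym (𝟙-mono d e f) (𝟙-mono e d g)

  𝟙-× : ∀ {ℓ ℓ′} {P : Set ℓ} {Q : Set ℓ′} (d : Dec P) (e : Dec Q) → 𝟙 (d ×-dec e) ≡ 𝟙 d * 𝟙 e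
  𝟙-× (yes _) (yes _) = refl
  𝟙-× (yes _) (no _)  = refl
  𝟙-× (no _)  _       = refl

  s≤1⇒s≤r : ∀ {s r} → (1 ≤ s → 1 ≤ r) → s ≤ 1 → s ≤ r
  s≤1⇒s≤r {zero}  _ _ = z≤n
  s≤1⇒s≤r {suc _} h (s≤s z≤n) = h (s≤s z≤n)

  ∑-mono : ∀ {n} {f g : Fin n → ℕ} → (∀ i → f i ≤ g i) → sum f ≤ sum g
  ∑-mono {zero}  _ = z≤n
  ∑-mono {suc n} h = +-mono-≤ (h zero) (∑-mono (λ i → h (suc i)))

  ∑-zero : ∀ {n} {f : Fin n → ℕ} → (∀ i → f i ≡ 0) → sum f ≡ 0
  ∑-zero {n} h = trans (sum-cong-≗ h) (sum-replicate-zero n)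

  ∑-*ˡ : ∀ {n} (c : ℕ) (f : Fin n → ℕ) → ∑[ i < n ] (c * f i) ≡ c * sum f
  ∑-*ˡ c f = sym (*-distribˡ-sum c f)

  ∑-*ʳ : ∀ {n} (c : ℕ) (f : Fin n → ℕ) → ∑[ i < n ] (f i * c) ≡ sum f * c
  ∑-*ʳ c f = sym (*-distribʳ-sum c f)

  ∑-positive : ∀ {n} (f : Fin n → ℕ) → 1 ≤ sum f → ∃[ i ] (1 ≤ f i)
  ∑-positive {suc n} f h with f zero in eq
  ... | suc _ = zero , subst (1 ≤_) (sym eq) (s≤s z≤n)
  ... | zero with i , 1≤fi ← ∑-positive (λ i → f (suc i)) h = suc i , 1≤fi

  ∑-δ : ∀ {n} (x : Fin n) (f : Fin n → ℕ) → ∑[ a < n ] (𝟙 (a ≟ x) * f a) ≡ f x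
  ∑-δ {suc n} zero f = begin
    1 * f zero + ∑[ i < n ] (𝟙 (suc i ≟ zero) * f (suc i))  ≡⟨ cong₂ _+_ (*-identityˡ (f zero)) (∑-zero {n} (λ _ → refl)) ⟩
    f zero + 0                                            ≡⟨ +-identityʳ (f zero) ⟩
    f zero                                                ∎
    where open ≡-Reasoning
  ∑-δ {suc n} (suc x) f = begin
    0 + ∑[ i < n ] (𝟙 (suc i ≟ suc x) * f (suc i))  ≡⟨ sum-cong-≗ (λ i → cong (_* f (suc i)) (𝟙-cong (suc i ≟ suc x) (i ≟ x) fsuc-injective (cong suc))) ⟩
    ∑[ i < n ] (𝟙 (i ≟ x) * f (suc i))              ≡⟨ ∑-δ x (λ i → f (suc i)) ⟩
    f (suc x)                                       ∎
    where open ≡-Reasoning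

  ∑∑-*ˡ : ∀ {m n} (c : ℕ) (f : Fin m → Fin n → ℕ) → ∑[ i < m ] ∑[ j < n ] (c * f i j) ≡ c * ∑[ i < m ] ∑[ j < n ] f i j
  ∑∑-*ˡ {n = n} c f = trans (sum-cong-≗ (λ i → ∑-*ˡ c (f i))) (∑-*ˡ c (λ i → ∑[ j < n ] f i j))

  ∑ᴸ : ∀ {a} {A : Set a} → List A → (A → ℕ) → ℕ
  ∑ᴸ []       f = 0
  ∑ᴸ (x ∷ xs) f = f x + ∑ᴸ xs f

  module _ {a} {A : Set a} where

    length-filter≡∑ᴸ : ∀ {p} {P : A → Set p} (P? : ∀ x → Dec (P x)) (xs : List A) →
                       length (filter P? xs) ≡ ∑ᴸ xs (λ x → 𝟙 (P? x))
    length-filter≡∑ᴸ P? []       = refl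
    length-filter≡∑ᴸ P? (x ∷ xs) with P? x
    ... | yes _ = cong suc (length-filter≡∑ᴸ P? xs)
    ... | no _  = length-filter≡∑ᴸ P? xs

    ∑ᴸ-cong-All : ∀ {r} {R : A → Set r} (xs : List A) {f g : A → ℕ} →
                  All R xs → (∀ x → R x → f x ≡ g x) → ∑ᴸ xs f ≡ ∑ᴸ xs g
    ∑ᴸ-cong-All []       []         _ = refl
    ∑ᴸ-cong-All (x ∷ xs) (rx ∷ rxs) h = cong₂ _+_ (h x rx) (∑ᴸ-cong-All xs rxs h)

    ∑ᴸ-cong : (xs : List A) {f g : A → ℕ} → (∀ x → f x ≡ g x) → ∑ᴸ xs f ≡ ∑ᴸ xs g
    ∑ᴸ-cong xs h = ∑ᴸ-cong-All xs (All.universal (λ _ → tt) xs) (λ x _ → h x)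

    ∑ᴸ-mono-All : ∀ {r} {R : A → Set r} (xs : List A) {f g : A → ℕ} →
                  All R xs → (∀ x → R x → f x ≤ g x) → ∑ᴸ xs f ≤ ∑ᴸ xs g
    ∑ᴸ-mono-All []       []         _ = z≤n
    ∑ᴸ-mono-All (x ∷ xs) (rx ∷ rxs) h = +-mono-≤ (h x rx) (∑ᴸ-mono-All xs rxs h)

    ∑ᴸ-mono : (xs : List A) {f g : A → ℕ} → (∀ x → f x ≤ g x) → ∑ᴸ xs f ≤ ∑ᴸ xs g
    ∑ᴸ-mono xs h = ∑ᴸ-mono-All xs (All.universal (λ _ → tt) xs) (λ x _ → h x)

    ∑ᴸ-*ˡ : (xs : List A) (c : ℕ) (f : A → ℕ) → ∑ᴸ xs (λ x → c * f x) ≡ c * ∑ᴸ xs f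
    ∑ᴸ-*ˡ []       c f = sym (*-zeroʳ c)
    ∑ᴸ-*ˡ (x ∷ xs) c f = trans (cong (c * f x +_) (∑ᴸ-*ˡ xs c f)) (sym (*-distribˡ-+ c (f x) _))

    ∑-∑ᴸ-comm : ∀ {n} (xs : List A) (f : Fin n → A → ℕ) →
                ∑[ i < n ] ∑ᴸ xs (f i) ≡ ∑ᴸ xs (λ x → ∑[ i < n ] f i x)
    ∑-∑ᴸ-comm {n} []       f = ∑-zero {n} (λ _ → refl)
    ∑-∑ᴸ-comm {n} (x ∷ xs) f = trans (∑-distrib-+ (λ i → f i x) (λ i → ∑ᴸ xs (f i)))
                                     (cong (∑[ i < n ] f i x +_) (∑-∑ᴸ-comm xs f))

    ∑∑-∑ᴸ-comm : ∀ {m n} (xs : List A) (f : Fin m → Fin n → A → ℕ) →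
                 ∑[ i < m ] ∑[ j < n ] ∑ᴸ xs (f i j) ≡ ∑ᴸ xs (λ x → ∑[ i < m ] ∑[ j < n ] f i j x)
    ∑∑-∑ᴸ-comm {n = n} xs f = trans (sum-cong-≗ (λ i → ∑-∑ᴸ-comm xs (f i))) (∑-∑ᴸ-comm xs (λ i x → ∑[ j < n ] f i j x))

    ∑ᴸ-tabulate : ∀ {n} (f : Fin n → A) (g : A → ℕ) → ∑ᴸ (tabulate f) g ≡ ∑[ i < n ] g (f i)
    ∑ᴸ-tabulate {zero}  f g = refl
    ∑ᴸ-tabulate {suc n} f g = cong (g (f zero) +_) (∑ᴸ-tabulate (f ∘ suc) g)

    Any⇒∑ᴸ-positive : ∀ {p} {P : A → Set p} (xs : List A) (f : A → ℕ) →
                      (∀ x → P x → 1 ≤ f x) → Any P xs → 1 ≤ ∑ᴸ xs f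
    Any⇒∑ᴸ-positive (x ∷ xs) f h (here px)  = ≤-trans (h x px) (m≤m+n (f x) _)
    Any⇒∑ᴸ-positive (x ∷ xs) f h (there ps) = ≤-trans (Any⇒∑ᴸ-positive xs f h ps) (m≤n+m _ (f x))

    ∑ᴸ-positive⇒Any : ∀ {p} {P : A → Set p} (P? : ∀ x → Dec (P x)) (xs : List A) →
                      1 ≤ ∑ᴸ xs (λ x → 𝟙 (P? x)) → Any P xs
    ∑ᴸ-positive⇒Any P? (x ∷ xs) h with P? x
    ... | yes px = here px
    ... | no _   = there (∑ᴸ-positive⇒Any P? xs h)

    ∑ᴸ-𝟙≤1 : ∀ {p r} {P : A → Set p} {R : A → Set r} (P? : ∀ x → Dec (P x)) (xs : List A) →
             AllPairs (λ x y → x ≢ y) xs → All R xs →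
             (∀ x y → R x → R y → P x → P y → x ≡ y) → ∑ᴸ xs (λ x → 𝟙 (P? x)) ≤ 1
    ∑ᴸ-𝟙≤1 P? []       _             _          _  = z≤n
    ∑ᴸ-𝟙≤1 {R = R} P? (x ∷ xs) (x∉xs ∷ uxs) (rx ∷ rxs) uq with P? x
    ... | no _   = ∑ᴸ-𝟙≤1 P? xs uxs rxs uq
    ... | yes px = s≤s (≤-reflexive (none xs x∉xs rxs))
      where
      none : ∀ ys → All (x ≢_) ys → All R ys → ∑ᴸ ys (λ y → 𝟙 (P? y)) ≡ 0
      none []       []           []         = refl
      none (y ∷ ys) (x≢y ∷ x∉ys) (ry ∷ rys) =
        cong₂ _+_ (𝟙-no (P? y) (λ py → x≢y (uq x y rx ry px py))) (none ys x∉ys rys)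

  ∣p∣≡∑𝟙 : ∀ {n} (p : Subset n) → ∣ p ∣ ≡ ∑[ i < n ] 𝟙 (i ∈? p)
  ∣p∣≡∑𝟙 []            = refl
  ∣p∣≡∑𝟙 (inside ∷ p)  = cong suc (trans (∣p∣≡∑𝟙 p) (sum-cong-≗ (λ i → 𝟙-cong (i ∈? p) (suc i ∈? (inside ∷ p)) there drop-there)))
  ∣p∣≡∑𝟙 (outside ∷ p) = trans (∣p∣≡∑𝟙 p) (sum-cong-≗ (λ i → 𝟙-cong (i ∈? p) (suc i ∈? (outside ∷ p)) there drop-there))

  x∈p-y⇒x∈p∧x≢y : ∀ {n} {x y : Fin n} {p : Subset n} → x ∈ p - y → x ∈ p × x ≢ y
  x∈p-y⇒x∈p∧x≢y {x = x} {y} {p} x∈p-y =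
    p─q⊆p p ⁅ y ⁆ x∈p-y , λ { refl → x∈p─q⇒x∉q p ⁅ y ⁆ x∈p-y (x∈⁅x⁆ y) }
    where
    x∈p─q⇒x∉q : ∀ {n} {x : Fin n} (p q : Subset n) → x ∈ p ─ q → x ∉ q
    x∈p─q⇒x∉q (_ ∷ p) (outside ∷ q) here       ()
    x∈p─q⇒x∉q (_ ∷ p) (_       ∷ q) (there x∈) (there x∈q) = x∈p─q⇒x∉q p q x∈ x∈q

  𝟙∈-split : ∀ {n} {x : Fin n} {p : Subset n} → x ∈ p → ∀ a → 𝟙 (a ∈? p) ≡ 𝟙 (a ∈? p - x) + 𝟙 (a ≟ x)
  𝟙∈-split {x = x} {p} x∈p a with a ≟ x
  ... | yes refl = trans (𝟙-yes (a ∈? p) x∈p) (cong (_+ 1) (sym (𝟙-no (a ∈? p - x) (λ a∈ → proj₂ (x∈p-y⇒x∈p∧x≢y a∈) refl))))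
  ... | no a≢x   = trans (𝟙-cong (a ∈? p) (a ∈? p - x) (λ a∈p → x∈p∧x≢y⇒x∈p-y a∈p a≢x) (λ a∈ → proj₁ (x∈p-y⇒x∈p∧x≢y a∈)))
                         (sym (+-identityʳ _))

  ∣p∣≡1+∣p-x∣ : ∀ {n} {x : Fin n} {p : Subset n} → x ∈ p → ∣ p ∣ ≡ suc ∣ p - x ∣
  ∣p∣≡1+∣p-x∣ {n} {x} {p} x∈p = begin
    ∣ p ∣                                                ≡⟨ ∣p∣≡∑𝟙 p ⟩
    ∑[ a < n ] 𝟙 (a ∈? p)                                ≡⟨ sum-cong-≗ (𝟙∈-split x∈p) ⟩
    ∑[ a < n ] (𝟙 (a ∈? p - x) + 𝟙 (a ≟ x))              ≡⟨ ∑-distrib-+ (λ a → 𝟙 (a ∈? p - x)) (λ a → 𝟙 (a ≟ x)) ⟩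
    ∑[ a < n ] 𝟙 (a ∈? p - x) + ∑[ a < n ] 𝟙 (a ≟ x)     ≡⟨ cong₂ _+_ (sym (∣p∣≡∑𝟙 (p - x))) ∑𝟙≟≡1 ⟩
    ∣ p - x ∣ + 1                                        ≡⟨ +-comm _ 1 ⟩
    suc ∣ p - x ∣                                        ∎
    where
    open ≡-Reasoning
    ∑𝟙≟≡1 : ∑[ a < n ] 𝟙 (a ≟ x) ≡ 1
    ∑𝟙≟≡1 = trans (sum-cong-≗ (λ a → sym (*-identityʳ (𝟙 (a ≟ x))))) (∑-δ x (λ _ → 1))

  [p-x]∩q≡[p∩q]-x : ∀ {n} (p q : Subset n) (x : Fin n) → (p - x) ∩ q ≡ (p ∩ q) - x
  [p-x]∩q≡[p∩q]-x p q x = ⊆-antisym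
    (λ y∈ → let y∈p-x , y∈q = x∈p∩q⁻ (p - x) q y∈ ; y∈p , y≢x = x∈p-y⇒x∈p∧x≢y y∈p-x
            in x∈p∧x≢y⇒x∈p-y (x∈p∩q⁺ (y∈p , y∈q)) y≢x)
    (λ y∈ → let y∈p∩q , y≢x = x∈p-y⇒x∈p∧x≢y y∈ ; y∈p , y∈q = x∈p∩q⁻ p q y∈p∩q
            in x∈p∩q⁺ (x∈p∧x≢y⇒x∈p-y y∈p y≢x , y∈q))

  [p-x]∩q≡p∩q : ∀ {n} (p q : Subset n) {x : Fin n} → x ∉ q → (p - x) ∩ q ≡ p ∩ q
  [p-x]∩q≡p∩q p q {x} x∉q = ⊆-antisym
    (λ y∈ → let y∈p-x , y∈q = x∈p∩q⁻ (p - x) q y∈ in x∈p∩q⁺ (proj₁ (x∈p-y⇒x∈p∧x≢y y∈p-x) , y∈q))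
    (λ y∈ → let y∈p , y∈q = x∈p∩q⁻ p q y∈ in x∈p∩q⁺ (x∈p∧x≢y⇒x∈p-y y∈p (λ { refl → x∉q y∈q }) , y∈q))

  ∁⁅x⁆∩p≡p : ∀ {n} {x : Fin n} {p : Subset n} → x ∉ p → ∁ ⁅ x ⁆ ∩ p ≡ p
  ∁⁅x⁆∩p≡p {x = x} {p} x∉p = ⊆-antisym (λ y∈ → proj₂ (x∈p∩q⁻ (∁ ⁅ x ⁆) p y∈))
    (λ y∈p → x∈p∩q⁺ (x∉p⇒x∈∁p (x≢y⇒x∉⁅y⁆ (λ { refl → x∉p y∈p })) , y∈p))

  ∈-3-set : ∀ {n} {e : Subset n} {a b c w : Fin n} → ∣ e ∣ ≡ 3 →
            a ∈ e → b ∈ e → c ∈ e → a ≢ b → a ≢ c → b ≢ c → w ∈ e →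
            w ≡ a ⊎ w ≡ b ⊎ w ≡ c
  ∈-3-set {e = e} {a} {b} {c} {w} ∣e∣≡3 a∈e b∈e c∈e a≢b a≢c b≢c w∈e with w ≟ a | w ≟ b | w ≟ c
  ... | yes w≡a | _       | _       = inj₁ w≡a
  ... | no _    | yes w≡b | _       = inj₂ (inj₁ w≡b)
  ... | no _    | no _    | yes w≡c = inj₂ (inj₂ w≡c)
  ... | no w≢a  | no w≢b  | no w≢c  = ⊥-elim (0≢1+n (suc-injective (suc-injective (suc-injective 3≡4+∣rest∣))))
    where
    b∈ : b ∈ e - a
    b∈ = x∈p∧x≢y⇒x∈p-y b∈e (a≢b ∘ sym)
    c∈ : c ∈ e - a - b
    c∈ = x∈p∧x≢y⇒x∈p-y (x∈p∧x≢y⇒x∈p-y c∈e (a≢c ∘ sym)) (b≢c ∘ sym)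
    w∈ : w ∈ e - a - b - c
    w∈ = x∈p∧x≢y⇒x∈p-y (x∈p∧x≢y⇒x∈p-y (x∈p∧x≢y⇒x∈p-y w∈e w≢a) w≢b) w≢c
    3≡4+∣rest∣ : 3 ≡ 4 + ∣ e - a - b - c - w ∣
    3≡4+∣rest∣ = begin
      3                                      ≡⟨ sym ∣e∣≡3 ⟩
      ∣ e ∣                                  ≡⟨ ∣p∣≡1+∣p-x∣ a∈e ⟩
      1 + ∣ e - a ∣                          ≡⟨ cong suc (∣p∣≡1+∣p-x∣ b∈) ⟩
      2 + ∣ e - a - b ∣                      ≡⟨ cong (2 +_) (∣p∣≡1+∣p-x∣ c∈) ⟩
      3 + ∣ e - a - b - c ∣                  ≡⟨ cong (3 +_) (∣p∣≡1+∣p-x∣ w∈) ⟩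
      4 + ∣ e - a - b - c - w ∣              ∎
      where open ≡-Reasoning

  top-average : ∀ {n} {T K : Subset n} (f : Fin n → ℕ) → T ⊆ K →
                (∀ t u → t ∈ T → u ∈ K → u ∉ T → f u ≤ f t) →
                ∣ T ∣ * ∑[ u < n ] (𝟙 (u ∈? K) * f u) ≤ ∑[ t < n ] (𝟙 (t ∈? T) * f t) * ∣ K ∣
  top-average {n} {T} {K} f T⊆K top = begin
    ∣ T ∣ * ∑[ u < n ] (𝟙 (u ∈? K) * f u)      ≡⟨ cong (∣ T ∣ *_) (∑-split-K (λ u → f u)) ⟩
    ∣ T ∣ * (fT + fR)                         ≡⟨ *-distribˡ-+ ∣ T ∣ fT fR ⟩
    ∣ T ∣ * fT + ∣ T ∣ * fR                    ≤⟨ +-monoʳ-≤ (∣ T ∣ * fT) rest≤ ⟩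
    ∣ T ∣ * fT + fT * ∣R∣                      ≡⟨ cong (_+ fT * ∣R∣) (*-comm ∣ T ∣ fT) ⟩
    fT * ∣ T ∣ + fT * ∣R∣                      ≡⟨ sym (*-distribˡ-+ fT ∣ T ∣ ∣R∣) ⟩
    fT * (∣ T ∣ + ∣R∣)                         ≡⟨ cong (fT *_) (sym ∣K∣≡∣T∣+∣R∣) ⟩
    fT * ∣ K ∣                                 ∎
    where
    open ≤-Reasoning
    rest? : ∀ u → Dec (u ∈ K × u ∉ T)
    rest? u = (u ∈? K) ×-dec ¬? (u ∈? T)
    fT = ∑[ t < n ] (𝟙 (t ∈? T) * f t)
    fR = ∑[ u < n ] (𝟙 (rest? u) * f u)
    ∣R∣ = ∑[ u < n ] 𝟙 (rest? u)
    𝟙K≡𝟙T+𝟙R : ∀ u → 𝟙 (u ∈? K) ≡ 𝟙 (u ∈? T) + 𝟙 (rest? u)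
    𝟙K≡𝟙T+𝟙R u with u ∈? T | u ∈? K
    ... | yes u∈T | no u∉K = ⊥-elim (u∉K (T⊆K u∈T))
    ... | yes _   | yes _  = refl
    ... | no _    | yes _  = refl
    ... | no _    | no _   = refl
    ∑-split-K : ∀ g → ∑[ u < n ] (𝟙 (u ∈? K) * g u) ≡ ∑[ u < n ] (𝟙 (u ∈? T) * g u) + ∑[ u < n ] (𝟙 (rest? u) * g u)
    ∑-split-K g = trans (sum-cong-≗ (λ u → trans (cong (_* g u) (𝟙K≡𝟙T+𝟙R u)) (*-distribʳ-+ (g u) (𝟙 (u ∈? T)) _)))
                        (∑-distrib-+ (λ u → 𝟙 (u ∈? T) * g u) (λ u → 𝟙 (rest? u) * g u))
    ∣K∣≡∣T∣+∣R∣ : ∣ K ∣ ≡ ∣ T ∣ + ∣R∣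
    ∣K∣≡∣T∣+∣R∣ = begin-equality
      ∣ K ∣                                                              ≡⟨ ∣p∣≡∑𝟙 K ⟩
      ∑[ u < n ] 𝟙 (u ∈? K)                                              ≡⟨ sum-cong-≗ (λ u → sym (*-identityʳ (𝟙 (u ∈? K)))) ⟩
      ∑[ u < n ] (𝟙 (u ∈? K) * 1)                                        ≡⟨ ∑-split-K (λ _ → 1) ⟩
      ∑[ u < n ] (𝟙 (u ∈? T) * 1) + ∑[ u < n ] (𝟙 (rest? u) * 1)         ≡⟨ cong₂ _+_ (trans (sum-cong-≗ (λ u → *-identityʳ (𝟙 (u ∈? T)))) (sym (∣p∣≡∑𝟙 T)))
                                                                                        (sum-cong-≗ (λ u → *-identityʳ (𝟙 (rest? u)))) ⟩
      ∣ T ∣ + ∣R∣                                                         ∎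
    pointwise : ∀ t u → 𝟙 (t ∈? T) * (𝟙 (rest? u) * f u) ≤ (𝟙 (t ∈? T) * f t) * 𝟙 (rest? u)
    pointwise t u with t ∈? T | rest? u
    ... | no _    | _                = z≤n
    ... | yes _   | no _             = z≤n
    ... | yes t∈T | yes (u∈K , u∉T) = subst₂ _≤_ (sym (trans (+-identityʳ _) (+-identityʳ _))) (sym (trans (*-identityʳ _) (+-identityʳ _)))
                                               (top t u t∈T u∈K u∉T)
    rest≤ : ∣ T ∣ * fR ≤ fT * ∣R∣
    rest≤ = begin
      ∣ T ∣ * fR                                                   ≡⟨ cong (_* fR) (∣p∣≡∑𝟙 T) ⟩
      ∑[ t < n ] 𝟙 (t ∈? T) * fR                                   ≡⟨ sym (∑-*ʳ fR (λ t → 𝟙 (t ∈? T))) ⟩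
      ∑[ t < n ] (𝟙 (t ∈? T) * fR)                                 ≡⟨ sum-cong-≗ (λ t → sym (∑-*ˡ (𝟙 (t ∈? T)) (λ u → 𝟙 (rest? u) * f u))) ⟩
      ∑[ t < n ] ∑[ u < n ] (𝟙 (t ∈? T) * (𝟙 (rest? u) * f u))      ≤⟨ ∑-mono (λ t → ∑-mono (pointwise t)) ⟩
      ∑[ t < n ] ∑[ u < n ] ((𝟙 (t ∈? T) * f t) * 𝟙 (rest? u))      ≡⟨ sum-cong-≗ (λ t → ∑-*ˡ (𝟙 (t ∈? T) * f t) (λ u → 𝟙 (rest? u))) ⟩
      ∑[ t < n ] ((𝟙 (t ∈? T) * f t) * ∣R∣)                          ≡⟨ ∑-*ʳ ∣R∣ (λ t → 𝟙 (t ∈? T) * f t) ⟩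
      fT * ∣R∣                                                     ∎

  degreeIn : ∀ {n} → Hypergraph n → Subset n → Fin n → ℕ
  degreeIn H W w = ∑ᴸ (edges H) (λ e → 𝟙 (w ∈? e) * 𝟙 (e ⊆? W))

  degreeIn≤degree : ∀ {n} (H : Hypergraph n) (W : Subset n) (w : Fin n) → degreeIn H W w ≤ degree H w
  degreeIn≤degree H W w = ≤-trans
    (∑ᴸ-mono (edges H) (λ e → ≤-trans (≤-reflexive (*-comm (𝟙 (w ∈? e)) _)) (𝟙*≤ (e ⊆? W) _)))
    (≤-reflexive (sym (length-filter≡∑ᴸ (w ∈?_) (edges H))))

  degreeIn≤inducedEdges : ∀ {n} (H : Hypergraph n) (W : Subset n) (w : Fin n) → degreeIn H W w ≤ inducedEdges H W
  degreeIn≤inducedEdges H W w = ≤-trans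
    (∑ᴸ-mono (edges H) (λ e → 𝟙*≤ (w ∈? e) _))
    (≤-reflexive (sym (length-filter≡∑ᴸ (_⊆? W) (edges H))))

  handshake : ∀ {n} (H : Hypergraph n) (W : Subset n) →
              ∑[ w < n ] (𝟙 (w ∈? W) * degreeIn H W w) ≡ 3 * inducedEdges H W
  handshake {n} H W = begin
    ∑[ w < n ] (𝟙 (w ∈? W) * degreeIn H W w)                    ≡⟨ sum-cong-≗ (λ w → sym (∑ᴸ-*ˡ E (𝟙 (w ∈? W)) _)) ⟩
    ∑[ w < n ] ∑ᴸ E (λ e → 𝟙 (w ∈? W) * (𝟙 (w ∈? e) * 𝟙 (e ⊆? W))) ≡⟨ ∑-∑ᴸ-comm E (λ w e → 𝟙 (w ∈? W) * (𝟙 (w ∈? e) * 𝟙 (e ⊆? W))) ⟩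
    ∑ᴸ E (λ e → ∑[ w < n ] (𝟙 (w ∈? W) * (𝟙 (w ∈? e) * 𝟙 (e ⊆? W)))) ≡⟨ ∑ᴸ-cong E (λ e → sum-cong-≗ (drop-𝟙∈W e)) ⟩
    ∑ᴸ E (λ e → ∑[ w < n ] (𝟙 (w ∈? e) * 𝟙 (e ⊆? W)))             ≡⟨ ∑ᴸ-cong E (λ e → trans (∑-*ʳ (𝟙 (e ⊆? W)) (λ w → 𝟙 (w ∈? e))) (cong (_* 𝟙 (e ⊆? W)) (sym (∣p∣≡∑𝟙 e)))) ⟩
    ∑ᴸ E (λ e → ∣ e ∣ * 𝟙 (e ⊆? W))                              ≡⟨ ∑ᴸ-cong-All E (uniform H) (λ e ∣e∣≡3 → cong (_* 𝟙 (e ⊆? W)) ∣e∣≡3) ⟩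
    ∑ᴸ E (λ e → 3 * 𝟙 (e ⊆? W))                                  ≡⟨ ∑ᴸ-*ˡ E 3 _ ⟩
    3 * ∑ᴸ E (λ e → 𝟙 (e ⊆? W))                                  ≡⟨ cong (3 *_) (sym (length-filter≡∑ᴸ (_⊆? W) E)) ⟩
    3 * inducedEdges H W                                         ∎
    where
    open ≡-Reasoning
    E = edges H
    drop-𝟙∈W : ∀ e w → 𝟙 (w ∈? W) * (𝟙 (w ∈? e) * 𝟙 (e ⊆? W)) ≡ 𝟙 (w ∈? e) * 𝟙 (e ⊆? W)
    drop-𝟙∈W e w with w ∈? W | w ∈? e | e ⊆? W
    ... | yes _ | _      | _      = +-identityʳ _
    ... | no _  | no _   | _      = refl
    ... | no _  | yes _  | no _   = refl
    ... | no w∉W | yes w∈e | yes e⊆W = ⊥-elim (w∉W (e⊆W w∈e))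

  densest-vertex : ∀ {n} (H : Hypergraph n) (W : Subset n) → 1 ≤ inducedEdges H W →
                   ∃[ v ] (v ∈ W × 1 ≤ degreeIn H W v × 3 * inducedEdges H W ≤ ∣ W ∣ * degreeIn H W v)
  densest-vertex {n} H W 1≤e = v , v∈W , 1≤D , 3e≤∣W∣D
    where
    D = degreeIn H W
    1≤∑ : 1 ≤ ∑[ w < n ] (𝟙 (w ∈? W) * D w)
    1≤∑ = ≤-trans (≤-trans (s≤s z≤n) (*-monoʳ-≤ 3 1≤e)) (≤-reflexive (sym (handshake H W)))
    positive-term = ∑-positive (λ w → 𝟙 (w ∈? W) * D w) 1≤∑
    w₀ = proj₁ positive-term
    w₀∈W : w₀ ∈ W
    w₀∈W = 𝟙*-positive (w₀ ∈? W) (D w₀) (proj₂ positive-term)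
    Ws = filter (_∈? W) (allFin n)
    v = argmax D w₀ Ws
    v∈W : v ∈ W
    v∈W = argmax-all D w₀∈W (all-filter (_∈? W) (allFin n))
    D≤Dv : ∀ w → w ∈ W → D w ≤ D v
    D≤Dv w w∈W = All.lookup (f[xs]≤f[argmax] w₀ Ws) (∈-filter⁺ (_∈? W) (∈-allFin w) w∈W)
    3e≤∣W∣D : 3 * inducedEdges H W ≤ ∣ W ∣ * D v
    3e≤∣W∣D = begin
      3 * inducedEdges H W                ≡⟨ sym (handshake H W) ⟩
      ∑[ w < n ] (𝟙 (w ∈? W) * D w)       ≤⟨ ∑-mono (λ w → 𝟙*-mono (w ∈? W) (D≤Dv w)) ⟩
      ∑[ w < n ] (𝟙 (w ∈? W) * D v)       ≡⟨ ∑-*ʳ (D v) (λ w → 𝟙 (w ∈? W)) ⟩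
      ∑[ w < n ] 𝟙 (w ∈? W) * D v         ≡⟨ cong (_* D v) (sym (∣p∣≡∑𝟙 W)) ⟩
      ∣ W ∣ * D v                         ∎
      where open ≤-Reasoning
    1≤D : 1 ≤ D v
    1≤D = n≢0⇒n>0 λ Dv≡0 → 0≢1+n (sym (n≤0⇒n≡0 (begin
      3                        ≤⟨ *-monoʳ-≤ 3 1≤e ⟩
      3 * inducedEdges H W     ≤⟨ 3e≤∣W∣D ⟩
      ∣ W ∣ * D v              ≡⟨ cong (∣ W ∣ *_) Dv≡0 ⟩
      ∣ W ∣ * 0                ≡⟨ *-zeroʳ ∣ W ∣ ⟩
      0                        ∎)))
      where open ≤-Reasoning

  module Link {n : ℕ} (H : Hypergraph n) (v : Fin n) where

    adj : Fin n → Fin n → ℕ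
    adj u x = 𝟙 (Gadj? H v u x)

    deg : Subset n → Fin n → ℕ
    deg S u = ∑[ x < n ] (𝟙 (x ∈? S) * adj u x)

    -- Ordered adjacent pairs in X × Y, so pairs X X is twice the number of edges of G_v[X].
    pairs : Subset n → Subset n → ℕ
    pairs X Y = ∑[ u < n ] (𝟙 (u ∈? X) * deg Y u)

    nbrsIn≡deg : ∀ S u → nbrsIn H v S u ≡ deg S u
    nbrsIn≡deg S u = begin
      nbrsIn H v S u                                     ≡⟨ length-filter≡∑ᴸ (λ x → (x ∈? S) ×-dec Gadj? H v u x) (allFin n) ⟩
      ∑ᴸ (allFin n) (λ x → 𝟙 ((x ∈? S) ×-dec Gadj? H v u x)) ≡⟨ ∑ᴸ-tabulate (λ x → x) (λ x → 𝟙 ((x ∈? S) ×-dec Gadj? H v u x)) ⟩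
      ∑[ x < n ] 𝟙 ((x ∈? S) ×-dec Gadj? H v u x)         ≡⟨ sum-cong-≗ (λ x → 𝟙-× (x ∈? S) (Gadj? H v u x)) ⟩
      deg S u                                            ∎
      where open ≡-Reasoning

    adj-sym : ∀ u x → adj u x ≡ adj x u
    adj-sym u x = 𝟙-cong (Gadj? H v u x) (Gadj? H v x u) swap swap
      where
      swap : ∀ {a b} → Gadj H v a b → Gadj H v b a
      swap (a≢b , a≢v , b≢v , e) = a≢b ∘ sym , b≢v , a≢v , Any.map (λ (v∈ , a∈ , b∈) → v∈ , b∈ , a∈) e

    adj-irrefl : ∀ u → adj u u ≡ 0
    adj-irrefl u = 𝟙-no (Gadj? H v u u) (λ g → proj₁ g refl)

    deg≤∣S∣ : ∀ S u → deg S u ≤ ∣ S ∣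
    deg≤∣S∣ S u = ≤-trans
      (∑-mono (λ x → ≤-trans (≤-reflexive (*-comm (𝟙 (x ∈? S)) _)) (𝟙*≤ (Gadj? H v u x) _)))
      (≤-reflexive (sym (∣p∣≡∑𝟙 S)))

    deg-mono : ∀ {S S′} → S ⊆ S′ → ∀ u → deg S u ≤ deg S′ u
    deg-mono {S} {S′} S⊆S′ u = ∑-mono (λ x → *-monoˡ-≤ (adj u x) (𝟙-mono (x ∈? S) (x ∈? S′) S⊆S′))

    pairs-mono : ∀ {X X′ Y Y′} → X ⊆ X′ → Y ⊆ Y′ → pairs X Y ≤ pairs X′ Y′
    pairs-mono {X} {X′} X⊆X′ Y⊆Y′ = ∑-mono (λ u → *-mono-≤ (𝟙-mono (u ∈? X) (u ∈? X′) X⊆X′) (deg-mono Y⊆Y′ u))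

    pairs≤∣X∣*∣Y∣ : ∀ X Y → pairs X Y ≤ ∣ X ∣ * ∣ Y ∣
    pairs≤∣X∣*∣Y∣ X Y = begin
      pairs X Y                         ≤⟨ ∑-mono (λ u → *-monoʳ-≤ (𝟙 (u ∈? X)) (deg≤∣S∣ Y u)) ⟩
      ∑[ u < n ] (𝟙 (u ∈? X) * ∣ Y ∣)   ≡⟨ ∑-*ʳ ∣ Y ∣ (λ u → 𝟙 (u ∈? X)) ⟩
      ∑[ u < n ] 𝟙 (u ∈? X) * ∣ Y ∣     ≡⟨ cong (_* ∣ Y ∣) (sym (∣p∣≡∑𝟙 X)) ⟩
      ∣ X ∣ * ∣ Y ∣                     ∎
      where open ≤-Reasoning

    pairs≡∑∑ : ∀ X Y → pairs X Y ≡ ∑[ u < n ] ∑[ x < n ] (𝟙 (u ∈? X) * (𝟙 (x ∈? Y) * adj u x))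
    pairs≡∑∑ X Y = sum-cong-≗ (λ u → sym (∑-*ˡ (𝟙 (u ∈? X)) (λ x → 𝟙 (x ∈? Y) * adj u x)))

    pairs-comm : ∀ X Y → pairs X Y ≡ pairs Y X
    pairs-comm X Y = begin
      pairs X Y                                                       ≡⟨ pairs≡∑∑ X Y ⟩
      ∑[ u < n ] ∑[ x < n ] (𝟙 (u ∈? X) * (𝟙 (x ∈? Y) * adj u x))     ≡⟨ ∑-comm (λ u x → 𝟙 (u ∈? X) * (𝟙 (x ∈? Y) * adj u x)) ⟩
      ∑[ x < n ] ∑[ u < n ] (𝟙 (u ∈? X) * (𝟙 (x ∈? Y) * adj u x))     ≡⟨ sum-cong-≗ (λ x → sum-cong-≗ (λ u → swap (𝟙 (u ∈? X)) (𝟙 (x ∈? Y)) (adj-sym u x))) ⟩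
      ∑[ x < n ] ∑[ u < n ] (𝟙 (x ∈? Y) * (𝟙 (u ∈? X) * adj x u))     ≡⟨ sym (pairs≡∑∑ Y X) ⟩
      pairs Y X                                                       ∎
      where
      open ≡-Reasoning
      swap : ∀ a b {g g′} → g ≡ g′ → a * (b * g) ≡ b * (a * g′)
      swap a b refl = *.x∙yz≈y∙xz a b _

    deg-remove : ∀ {X u} → u ∈ X → ∀ a → deg X a ≡ deg (X - u) a + adj a u
    deg-remove {X} {u} u∈X a = begin
      ∑[ b < n ] (𝟙 (b ∈? X) * adj a b)                                 ≡⟨ sum-cong-≗ (λ b → trans (cong (_* adj a b) (𝟙∈-split u∈X b)) (*-distribʳ-+ (adj a b) (𝟙 (b ∈? X - u)) _)) ⟩
      ∑[ b < n ] (𝟙 (b ∈? X - u) * adj a b + 𝟙 (b ≟ u) * adj a b)        ≡⟨ ∑-distrib-+ (λ b → 𝟙 (b ∈? X - u) * adj a b) (λ b → 𝟙 (b ≟ u) * adj a b) ⟩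
      deg (X - u) a + ∑[ b < n ] (𝟙 (b ≟ u) * adj a b)                  ≡⟨ cong (deg (X - u) a +_) (∑-δ u (adj a)) ⟩
      deg (X - u) a + adj a u                                           ∎
      where open ≡-Reasoning

    pairs-remove : ∀ {X u} → u ∈ X → pairs X X ≡ pairs (X - u) (X - u) + 2 * deg (X - u) u
    pairs-remove {X} {u} u∈X = begin
      ∑[ a < n ] (𝟙 (a ∈? X) * deg X a)                                    ≡⟨ sum-cong-≗ (λ a → trans (cong₂ _*_ (𝟙∈-split u∈X a) (deg-remove u∈X a)) (*-distribʳ-+ (deg X′ a + adj a u) (𝟙 (a ∈? X′)) _)) ⟩
      ∑[ a < n ] (𝟙 (a ∈? X′) * (deg X′ a + adj a u) + 𝟙 (a ≟ u) * (deg X′ a + adj a u))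
                                                                           ≡⟨ ∑-distrib-+ (λ a → 𝟙 (a ∈? X′) * (deg X′ a + adj a u)) (λ a → 𝟙 (a ≟ u) * (deg X′ a + adj a u)) ⟩
      ∑[ a < n ] (𝟙 (a ∈? X′) * (deg X′ a + adj a u)) + ∑[ a < n ] (𝟙 (a ≟ u) * (deg X′ a + adj a u))
                                                                           ≡⟨ cong₂ _+_ inner (∑-δ u (λ a → deg X′ a + adj a u)) ⟩
      (pairs X′ X′ + deg X′ u) + (deg X′ u + adj u u)                      ≡⟨ cong (λ z → (pairs X′ X′ + deg X′ u) + (deg X′ u + z)) (adj-irrefl u) ⟩
      (pairs X′ X′ + deg X′ u) + (deg X′ u + 0)                            ≡⟨ +-assoc (pairs X′ X′) (deg X′ u) _ ⟩
      pairs X′ X′ + 2 * deg X′ u                                           ∎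
      where
      open ≡-Reasoning
      X′ = X - u
      inner : ∑[ a < n ] (𝟙 (a ∈? X′) * (deg X′ a + adj a u)) ≡ pairs X′ X′ + deg X′ u
      inner = begin
        ∑[ a < n ] (𝟙 (a ∈? X′) * (deg X′ a + adj a u))                      ≡⟨ sum-cong-≗ (λ a → *-distribˡ-+ (𝟙 (a ∈? X′)) (deg X′ a) (adj a u)) ⟩
        ∑[ a < n ] (𝟙 (a ∈? X′) * deg X′ a + 𝟙 (a ∈? X′) * adj a u)          ≡⟨ ∑-distrib-+ (λ a → 𝟙 (a ∈? X′) * deg X′ a) (λ a → 𝟙 (a ∈? X′) * adj a u) ⟩
        pairs X′ X′ + ∑[ a < n ] (𝟙 (a ∈? X′) * adj a u)                     ≡⟨ cong (pairs X′ X′ +_) (sum-cong-≗ (λ a → cong (𝟙 (a ∈? X′) *_) (adj-sym a u))) ⟩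
        pairs X′ X′ + deg X′ u                                               ∎

    Spans : Subset n → Fin n → Fin n → Set
    Spans e u x = u ≢ x × u ≢ v × x ≢ v × v ∈ e × u ∈ e × x ∈ e

    spans? : ∀ e u x → Dec (Spans e u x)
    spans? e u x = ¬? (u ≟ x) ×-dec (¬? (u ≟ v) ×-dec (¬? (x ≟ v) ×-dec ((v ∈? e) ×-dec ((u ∈? e) ×-dec (x ∈? e)))))

    spans : Subset n → Fin n → Fin n → ℕ
    spans e u x = 𝟙 (spans? e u x)

    Spans⇒∈ : ∀ {e u x w} → ∣ e ∣ ≡ 3 → Spans e u x → w ∈ e → w ≡ v ⊎ w ≡ u ⊎ w ≡ x
    Spans⇒∈ ∣e∣≡3 (u≢x , u≢v , x≢v , v∈e , u∈e , x∈e) = ∈-3-set ∣e∣≡3 v∈e u∈e x∈e (u≢v ∘ sym) (x≢v ∘ sym) u≢x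

    Spans⇒⊆ : ∀ {e u x R} → ∣ e ∣ ≡ 3 → Spans e u x → v ∈ R → u ∈ R → x ∈ R → e ⊆ R
    Spans⇒⊆ ∣e∣≡3 s v∈R u∈R x∈R w∈e with Spans⇒∈ ∣e∣≡3 s w∈e
    ... | inj₁ refl        = v∈R
    ... | inj₂ (inj₁ refl) = u∈R
    ... | inj₂ (inj₂ refl) = x∈R

    ∑∑spans : ∀ {e} → ∣ e ∣ ≡ 3 → ∑[ u < n ] ∑[ x < n ] spans e u x ≡ 2 * 𝟙 (v ∈? e)
    ∑∑spans {e} ∣e∣≡3 = by-cases (v ∈? e)
      where
      by-cases : (v∈e? : Dec (v ∈ e)) → ∑[ u < n ] ∑[ x < n ] spans e u x ≡ 2 * 𝟙 v∈e?
      by-cases (no v∉e) = ∑-zero (λ u → ∑-zero (λ x → 𝟙-no (spans? e u x) (v∉e ∘ proj₁ ∘ proj₂ ∘ proj₂ ∘ proj₂)))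
      by-cases (yes v∈e) = begin
        ∑[ u < n ] ∑[ x < n ] spans e u x                             ≡⟨ sum-cong-≗ (λ u → sum-cong-≗ (spans≡ u)) ⟩
        ∑[ u < n ] ∑[ x < n ] (𝟙 (u ∈? e - v) * 𝟙 (x ∈? e - v - u))   ≡⟨ sum-cong-≗ (λ u → ∑-*ˡ (𝟙 (u ∈? e - v)) (λ x → 𝟙 (x ∈? e - v - u))) ⟩
        ∑[ u < n ] (𝟙 (u ∈? e - v) * ∑[ x < n ] 𝟙 (x ∈? e - v - u))  ≡⟨ sum-cong-≗ (λ u → cong (𝟙 (u ∈? e - v) *_) (sym (∣p∣≡∑𝟙 (e - v - u)))) ⟩
        ∑[ u < n ] (𝟙 (u ∈? e - v) * ∣ e - v - u ∣)                   ≡⟨ sum-cong-≗ last-one ⟩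
        ∑[ u < n ] 𝟙 (u ∈? e - v)                                     ≡⟨ sym (∣p∣≡∑𝟙 (e - v)) ⟩
        ∣ e - v ∣                                                     ≡⟨ ∣e-v∣≡2 ⟩
        2                                                             ∎
        where
        open ≡-Reasoning
        ∣e-v∣≡2 : ∣ e - v ∣ ≡ 2
        ∣e-v∣≡2 = suc-injective (trans (sym (∣p∣≡1+∣p-x∣ v∈e)) ∣e∣≡3)
        last-one : ∀ u → 𝟙 (u ∈? e - v) * ∣ e - v - u ∣ ≡ 𝟙 (u ∈? e - v)
        last-one u with u ∈? e - v
        ... | yes u∈ = trans (+-identityʳ _) (suc-injective (trans (sym (∣p∣≡1+∣p-x∣ u∈)) ∣e-v∣≡2))
        ... | no _   = refl
        spans≡ : ∀ u x → spans e u x ≡ 𝟙 (u ∈? e - v) * 𝟙 (x ∈? e - v - u)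
        spans≡ u x = trans (𝟙-cong (spans? e u x) ((u ∈? e - v) ×-dec (x ∈? e - v - u)) to from) (𝟙-× (u ∈? e - v) (x ∈? e - v - u))
          where
          to : Spans e u x → u ∈ e - v × x ∈ e - v - u
          to (u≢x , u≢v , x≢v , _ , u∈e , x∈e) = x∈p∧x≢y⇒x∈p-y u∈e u≢v , x∈p∧x≢y⇒x∈p-y (x∈p∧x≢y⇒x∈p-y x∈e x≢v) (u≢x ∘ sym)
          from : u ∈ e - v × x ∈ e - v - u → Spans e u x
          from (u∈ , x∈) with u∈e , u≢v ← x∈p-y⇒x∈p∧x≢y u∈ | x∈e-v , x≢u ← x∈p-y⇒x∈p∧x≢y x∈
                         with x∈e , x≢v ← x∈p-y⇒x∈p∧x≢y x∈e-v = x≢u ∘ sym , u≢v , x≢v , v∈e , u∈e , x∈e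

    adj≤∑ᴸspans : ∀ u x → adj u x ≤ ∑ᴸ (edges H) (λ e → spans e u x)
    adj≤∑ᴸspans u x with Gadj? H v u x
    ... | no _                             = z≤n
    ... | yes (u≢x , u≢v , x≢v , some-edge) = Any⇒∑ᴸ-positive (edges H) (λ e → spans e u x)
            (λ e (v∈e , u∈e , x∈e) → ≤-reflexive (sym (𝟙-yes (spans? e u x) (u≢x , u≢v , x≢v , v∈e , u∈e , x∈e))))
            some-edge

    ∑ᴸspans-inside≤adj : ∀ W u x → ∑ᴸ (edges H) (λ e → 𝟙 (e ⊆? W) * spans e u x) ≤ 𝟙 (u ∈? W - v) * (𝟙 (x ∈? W - v) * adj u x)
    ∑ᴸspans-inside≤adj W u x = begin
      ∑ᴸ E (λ e → 𝟙 (e ⊆? W) * spans e u x)      ≡⟨ ∑ᴸ-cong E (λ e → sym (𝟙-× (e ⊆? W) (spans? e u x))) ⟩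
      ∑ᴸ E (λ e → 𝟙 (inside? e))                 ≤⟨ s≤1⇒s≤r spanning-edge⇒adj (∑ᴸ-𝟙≤1 inside? E (distinct H) (uniform H) spanning-edge-unique) ⟩
      𝟙 (u ∈? W - v) * (𝟙 (x ∈? W - v) * adj u x) ∎
      where
      open ≤-Reasoning
      E = edges H
      inside? : ∀ e → Dec (e ⊆ W × Spans e u x)
      inside? e = (e ⊆? W) ×-dec spans? e u x
      spanning-edge-unique : ∀ a b → ∣ a ∣ ≡ 3 → ∣ b ∣ ≡ 3 → a ⊆ W × Spans a u x → b ⊆ W × Spans b u x → a ≡ b
      spanning-edge-unique a b ∣a∣≡3 ∣b∣≡3 (_ , sa@(_ , _ , _ , v∈a , u∈a , x∈a)) (_ , sb@(_ , _ , _ , v∈b , u∈b , x∈b)) =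
        ⊆-antisym (Spans⇒⊆ ∣a∣≡3 sa v∈b u∈b x∈b) (Spans⇒⊆ ∣b∣≡3 sb v∈a u∈a x∈a)
      spanning-edge⇒adj : 1 ≤ ∑ᴸ E (λ e → 𝟙 (inside? e)) → 1 ≤ 𝟙 (u ∈? W - v) * (𝟙 (x ∈? W - v) * adj u x)
      spanning-edge⇒adj 1≤∑ with some ← ∑ᴸ-positive⇒Any inside? E 1≤∑
                            with e , e⊆W , (u≢x , u≢v , x≢v , v∈e , u∈e , x∈e) ← Any.satisfied some = ≤-reflexive (sym (cong₂ _*_
            (𝟙-yes (u ∈? W - v) (x∈p∧x≢y⇒x∈p-y (e⊆W u∈e) u≢v))
            (cong₂ _*_ (𝟙-yes (x ∈? W - v) (x∈p∧x≢y⇒x∈p-y (e⊆W x∈e) x≢v))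
                       (𝟙-yes (Gadj? H v u x) (u≢x , u≢v , x≢v , Any.map (λ (_ , (_ , _ , _ , v∈ , u∈ , x∈)) → v∈ , u∈ , x∈) some)))))

    ∑∑spans-inside : ∀ R {e} → ∣ e ∣ ≡ 3 →
                     ∑[ u < n ] ∑[ x < n ] (𝟙 (e ⊆? R) * spans e u x) ≡ 2 * (𝟙 (v ∈? e) * 𝟙 (e ⊆? R))
    ∑∑spans-inside R {e} ∣e∣≡3 = begin
      ∑[ u < n ] ∑[ x < n ] (𝟙 (e ⊆? R) * spans e u x)   ≡⟨ ∑∑-*ˡ (𝟙 (e ⊆? R)) (spans e) ⟩
      𝟙 (e ⊆? R) * ∑[ u < n ] ∑[ x < n ] spans e u x     ≡⟨ cong (𝟙 (e ⊆? R) *_) (∑∑spans ∣e∣≡3) ⟩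
      𝟙 (e ⊆? R) * (2 * 𝟙 (v ∈? e))                      ≡⟨ *.x∙yz≈y∙zx (𝟙 (e ⊆? R)) 2 (𝟙 (v ∈? e)) ⟩
      2 * (𝟙 (v ∈? e) * 𝟙 (e ⊆? R))                      ∎
      where open ≡-Reasoning

    pairs≤2*degreeIn : ∀ {X Y R} → v ∈ R → X ⊆ R → Y ⊆ R → pairs X Y ≤ 2 * degreeIn H R v
    pairs≤2*degreeIn {X} {Y} {R} v∈R X⊆R Y⊆R = begin
      pairs X Y                                                              ≡⟨ pairs≡∑∑ X Y ⟩
      ∑[ u < n ] ∑[ x < n ] (𝟙 (u ∈? X) * (𝟙 (x ∈? Y) * adj u x))            ≤⟨ ∑-mono (λ u → ∑-mono (λ x → *-monoʳ-≤ (𝟙 (u ∈? X)) (*-monoʳ-≤ (𝟙 (x ∈? Y)) (adj≤∑ᴸspans u x)))) ⟩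
      ∑[ u < n ] ∑[ x < n ] (𝟙 (u ∈? X) * (𝟙 (x ∈? Y) * ∑ᴸ E (λ e → spans e u x)))
                                                                             ≡⟨ sum-cong-≗ (λ u → sum-cong-≗ (λ x → sym (pull-𝟙 u x))) ⟩
      ∑[ u < n ] ∑[ x < n ] ∑ᴸ E (term u x)                                  ≡⟨ ∑∑-∑ᴸ-comm E term ⟩
      ∑ᴸ E (λ e → ∑[ u < n ] ∑[ x < n ] term u x e)                          ≤⟨ ∑ᴸ-mono-All E (uniform H) per-edge ⟩
      ∑ᴸ E (λ e → 2 * (𝟙 (v ∈? e) * 𝟙 (e ⊆? R)))                            ≡⟨ ∑ᴸ-*ˡ E 2 (λ e → 𝟙 (v ∈? e) * 𝟙 (e ⊆? R)) ⟩
      2 * degreeIn H R v                                                     ∎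
      where
      open ≤-Reasoning
      E = edges H
      term : Fin n → Fin n → Subset n → ℕ
      term u x e = 𝟙 (u ∈? X) * (𝟙 (x ∈? Y) * spans e u x)
      pull-𝟙 : ∀ u x → ∑ᴸ E (term u x) ≡ 𝟙 (u ∈? X) * (𝟙 (x ∈? Y) * ∑ᴸ E (λ e → spans e u x))
      pull-𝟙 u x = trans (∑ᴸ-*ˡ E (𝟙 (u ∈? X)) _) (cong (𝟙 (u ∈? X) *_) (∑ᴸ-*ˡ E (𝟙 (x ∈? Y)) (λ e → spans e u x)))
      term≤ : ∀ {e} → ∣ e ∣ ≡ 3 → ∀ u x → term u x e ≤ 𝟙 (e ⊆? R) * spans e u x
      term≤ {e} ∣e∣≡3 u x with u ∈? X | x ∈? Y | spans? e u x | e ⊆? R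
      ... | no _   | _      | _      | _       = z≤n
      ... | yes _  | no _   | _      | _       = z≤n
      ... | yes _  | yes _  | no _   | _       = z≤n
      ... | yes _  | yes _  | yes _  | yes _   = ≤-refl
      ... | yes u∈X | yes x∈Y | yes s | no e⊈R = ⊥-elim (e⊈R (Spans⇒⊆ ∣e∣≡3 s v∈R (X⊆R u∈X) (Y⊆R x∈Y)))
      per-edge : ∀ e → ∣ e ∣ ≡ 3 → ∑[ u < n ] ∑[ x < n ] term u x e ≤ 2 * (𝟙 (v ∈? e) * 𝟙 (e ⊆? R))
      per-edge e ∣e∣≡3 = ≤-trans (∑-mono (λ u → ∑-mono (term≤ ∣e∣≡3 u))) (≤-reflexive (∑∑spans-inside R ∣e∣≡3))

    pairs≤2*degree : ∀ X Y → pairs X Y ≤ 2 * degree H v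
    pairs≤2*degree X Y = ≤-trans (pairs≤2*degreeIn ∈⊤ (λ _ → ∈⊤) (λ _ → ∈⊤)) (*-monoʳ-≤ 2 (degreeIn≤degree H ⊤ v))

    2*degreeIn≤pairs : ∀ W → 2 * degreeIn H W v ≤ pairs (W - v) (W - v)
    2*degreeIn≤pairs W = begin
      2 * degreeIn H W v                                            ≡⟨ sym (∑ᴸ-*ˡ E 2 (λ e → 𝟙 (v ∈? e) * 𝟙 (e ⊆? W))) ⟩
      ∑ᴸ E (λ e → 2 * (𝟙 (v ∈? e) * 𝟙 (e ⊆? W)))                   ≡⟨ ∑ᴸ-cong-All E (uniform H) (λ e ∣e∣≡3 → sym (∑∑spans-inside W ∣e∣≡3)) ⟩
      ∑ᴸ E (λ e → ∑[ u < n ] ∑[ x < n ] (𝟙 (e ⊆? W) * spans e u x)) ≡⟨ sym (∑∑-∑ᴸ-comm E (λ u x e → 𝟙 (e ⊆? W) * spans e u x)) ⟩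
      ∑[ u < n ] ∑[ x < n ] ∑ᴸ E (λ e → 𝟙 (e ⊆? W) * spans e u x)  ≤⟨ ∑-mono (λ u → ∑-mono (∑ᴸspans-inside≤adj W u)) ⟩
      ∑[ u < n ] ∑[ x < n ] (𝟙 (u ∈? W - v) * (𝟙 (x ∈? W - v) * adj u x)) ≡⟨ sym (pairs≡∑∑ (W - v) (W - v)) ⟩
      pairs (W - v) (W - v)                                         ∎
      where
      open ≤-Reasoning
      E = edges H

    -- pairs W₀ W₀ − pairs X X ≤ 2·dd·(∣W₀∣ − ∣X∣), written without truncated subtraction.
    PeelingBound : ℕ → Subset n → Subset n → Set
    PeelingBound dd W₀ X = pairs W₀ W₀ + 2 * dd * ∣ X ∣ ≤ pairs X X + 2 * dd * ∣ W₀ ∣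

    PeelingBound-remove : ∀ {dd W₀ X u} → u ∈ X → deg (X - u) u ≤ dd → PeelingBound dd W₀ X → PeelingBound dd W₀ (X - u)
    PeelingBound-remove {dd} {W₀} {X} {u} u∈X deg≤dd bound = +-cancelʳ-≤ (2 * dd) _ _ (begin
      pairs W₀ W₀ + 2 * dd * ∣ X′ ∣ + 2 * dd          ≡⟨ +.xy∙z≈x∙zy (pairs W₀ W₀) _ _ ⟩
      pairs W₀ W₀ + (2 * dd + 2 * dd * ∣ X′ ∣)        ≡⟨ cong (pairs W₀ W₀ +_) (sym (*-suc (2 * dd) ∣ X′ ∣)) ⟩
      pairs W₀ W₀ + 2 * dd * suc ∣ X′ ∣               ≡⟨ cong (λ z → pairs W₀ W₀ + 2 * dd * z) (sym (∣p∣≡1+∣p-x∣ u∈X)) ⟩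
      pairs W₀ W₀ + 2 * dd * ∣ X ∣                    ≤⟨ bound ⟩
      pairs X X + 2 * dd * ∣ W₀ ∣                     ≡⟨ cong (_+ 2 * dd * ∣ W₀ ∣) (pairs-remove u∈X) ⟩
      pairs X′ X′ + 2 * deg X′ u + 2 * dd * ∣ W₀ ∣    ≤⟨ +-monoˡ-≤ (2 * dd * ∣ W₀ ∣) (+-monoʳ-≤ (pairs X′ X′) (*-monoʳ-≤ 2 deg≤dd)) ⟩
      pairs X′ X′ + 2 * dd + 2 * dd * ∣ W₀ ∣          ≡⟨ +.xy∙z≈xz∙y (pairs X′ X′) _ _ ⟩
      pairs X′ X′ + 2 * dd * ∣ W₀ ∣ + 2 * dd          ∎)
      where
      open ≤-Reasoning
      X′ = X - u

    peel-step : ∀ {dd W₀ C C′} → PeelStep H v (suc dd) C C′ → PeelingBound dd W₀ (C ∩ W₀) → PeelingBound dd W₀ (C′ ∩ W₀)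
    peel-step {dd} {W₀} {C} (u , u∈C , deg<1+dd , refl) bound with u ∈? W₀
    ... | no u∉W₀  = subst (PeelingBound dd W₀) (sym ([p-x]∩q≡p∩q C W₀ u∉W₀)) bound
    ... | yes u∈W₀ = subst (PeelingBound dd W₀) (sym ([p-x]∩q≡[p∩q]-x C W₀ u))
                       (PeelingBound-remove (x∈p∩q⁺ (u∈C , u∈W₀)) deg≤dd bound)
      where
      C∩W₀-u⊆C : (C ∩ W₀) - u ⊆ C
      C∩W₀-u⊆C x∈ = proj₁ (x∈p∩q⁻ C W₀ (proj₁ (x∈p-y⇒x∈p∧x≢y x∈)))
      deg≤dd : deg ((C ∩ W₀) - u) u ≤ dd
      deg≤dd = ≤-pred (≤-trans (s≤s (deg-mono C∩W₀-u⊆C u)) (subst (_< suc dd) (nbrsIn≡deg C u) deg<1+dd))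

    peeling-bound : ∀ {dd W₀ C} → v ∉ W₀ → Star (PeelStep H v (suc dd)) (∁ ⁅ v ⁆) C → PeelingBound dd W₀ (C ∩ W₀)
    peeling-bound {dd} {W₀} v∉W₀ steps = go steps start
      where
      start : PeelingBound dd W₀ (∁ ⁅ v ⁆ ∩ W₀)
      start = subst (PeelingBound dd W₀) (sym (∁⁅x⁆∩p≡p v∉W₀)) ≤-refl
      go : ∀ {A B} → Star (PeelStep H v (suc dd)) A B → PeelingBound dd W₀ (A ∩ W₀) → PeelingBound dd W₀ (B ∩ W₀)
      go ε        bound = bound
      go (s ◅ ss) bound = go ss (peel-step s bound)

    peeled-pairs : ∀ {dd W₀ C D} → v ∉ W₀ → Star (PeelStep H v (suc dd)) (∁ ⁅ v ⁆) C →
                   2 * D ≤ pairs W₀ W₀ → dd * (2 * ∣ W₀ ∣) ≤ D → D ≤ pairs C C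
    peeled-pairs {dd} {W₀} {C} {D} v∉W₀ steps 2D≤ dd*2k₁≤D = ≤-trans (+-cancelʳ-≤ D D _ (begin
      D + D                                            ≡⟨ cong (D +_) (sym (+-identityʳ D)) ⟩
      2 * D                                            ≤⟨ 2D≤ ⟩
      pairs W₀ W₀                                      ≤⟨ m≤m+n (pairs W₀ W₀) _ ⟩
      pairs W₀ W₀ + 2 * dd * ∣ C ∩ W₀ ∣                ≤⟨ peeling-bound v∉W₀ steps ⟩
      pairs (C ∩ W₀) (C ∩ W₀) + 2 * dd * ∣ W₀ ∣        ≤⟨ +-monoʳ-≤ _ (≤-trans (≤-reflexive (*.xy∙z≈y∙xz 2 dd ∣ W₀ ∣)) dd*2k₁≤D) ⟩
      pairs (C ∩ W₀) (C ∩ W₀) + D                      ∎))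
      (pairs-mono (p∩q⊆p C W₀) (p∩q⊆p C W₀))
      where open ≤-Reasoning

  module Greedy {n} {H : Hypergraph n} {k : ℕ} {v : Fin n} {dh : ℕ} (ch : Choice H k v dh) where

    open Choice ch
    open Link H v

    core-min-degree : ∣ core ∣ * dh ≤ pairs core core
    core-min-degree = begin
      ∣ core ∣ * dh                         ≡⟨ cong (_* dh) (∣p∣≡∑𝟙 core) ⟩
      ∑[ u < n ] 𝟙 (u ∈? core) * dh         ≡⟨ sym (∑-*ʳ dh (λ u → 𝟙 (u ∈? core))) ⟩
      ∑[ u < n ] (𝟙 (u ∈? core) * dh)       ≤⟨ ∑-mono (λ u → 𝟙*-mono (u ∈? core) (λ u∈ → subst (dh ≤_) (nbrsIn≡deg core u) (proj₂ peeled u u∈))) ⟩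
      pairs core core                       ∎
      where open ≤-Reasoning

    S-average : ∣ S ∣ * pairs core core ≤ pairs S core * ∣ core ∣
    S-average = top-average (deg core) S⊆
      (λ s u s∈S u∈core u∉S → subst₂ _≤_ (nbrsIn≡deg core u) (nbrsIn≡deg core s) (S-top s u s∈S u∈core u∉S))

    ∣T∣≡∣S∣ : ∣ T ∣ ≡ ∣ S ∣
    ∣T∣≡∣S∣ = trans T-size (sym S-size)

    T-average : ∣ S ∣ * pairs S core ≤ pairs T S * ∣ core ∣
    T-average = subst₂ (λ a b → a * b ≤ pairs T S * ∣ core ∣) ∣T∣≡∣S∣ (pairs-comm core S)
      (top-average (deg S) T⊆ (λ t u t∈T u∈core u∉T → subst₂ _≤_ (nbrsIn≡deg S u) (nbrsIn≡deg S t) (T-top t u t∈T u∈core u∉T)))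

    pairs-T-S≤2*inducedEdges : pairs T S ≤ 2 * inducedEdges H (output ch)
    pairs-T-S≤2*inducedEdges = ≤-trans
      (pairs≤2*degreeIn (x∈p∪q⁺ (inj₁ (x∈⁅x⁆ v))) (λ t∈ → x∈p∪q⁺ (inj₂ (x∈p∪q⁺ (inj₂ t∈)))) (λ s∈ → x∈p∪q⁺ (inj₂ (x∈p∪q⁺ (inj₁ s∈)))))
      (*-monoʳ-≤ 2 (degreeIn≤inducedEdges H (output ch) v))

    module _ .{{_ : NonZero ∣ core ∣}} where

      small-core : ∣ core ∣ ≤ half k → pairs core core ≤ pairs T S
      small-core κ≤m = ≤-trans (*-cancelˡ-≤ ∣ core ∣ (subst₂ _≤_ (cong (_* pairs core core) ∣S∣≡κ) (*-comm (pairs S core) _) S-average))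
                               (*-cancelˡ-≤ ∣ core ∣ (subst₂ _≤_ (cong (_* pairs S core) ∣S∣≡κ) (*-comm (pairs T S) _) T-average))
        where
        ∣S∣≡κ : ∣ S ∣ ≡ ∣ core ∣
        ∣S∣≡κ = trans S-size (m≥n⇒m⊓n≡n κ≤m)

      large-core : half k ≤ ∣ core ∣ → half k * dh * (half k * dh) ≤ pairs T S * pairs core core
      large-core m≤κ = begin
        m * dh * (m * dh)     ≡⟨ regroup m dh ⟩
        m * (m * dh) * dh     ≤⟨ *-monoˡ-≤ dh (*-monoʳ-≤ m mdh≤B) ⟩
        m * B * dh            ≤⟨ *-monoˡ-≤ dh (subst (λ z → z * B ≤ P * κ) ∣S∣≡m T-average) ⟩
        P * κ * dh            ≡⟨ *-assoc P κ dh ⟩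
        P * (κ * dh)          ≤⟨ *-monoʳ-≤ P core-min-degree ⟩
        P * G                 ∎
        where
        open ≤-Reasoning
        regroup : ∀ a b → a * b * (a * b) ≡ a * (a * b) * b
        regroup = solve-∀
        κ = ∣ core ∣
        m = half k
        G = pairs core core
        B = pairs S core
        P = pairs T S
        ∣S∣≡m : ∣ S ∣ ≡ m
        ∣S∣≡m = trans S-size (m≤n⇒m⊓n≡m m≤κ)
        mdh≤B : m * dh ≤ B
        mdh≤B = *-cancelʳ-≤ (m * dh) B κ (begin
          m * dh * κ     ≡⟨ *.xy∙z≈x∙zy m dh κ ⟩
          m * (κ * dh)   ≤⟨ *-monoʳ-≤ m core-min-degree ⟩
          m * G          ≡⟨ cong (_* G) (sym ∣S∣≡m) ⟩
          ∣ S ∣ * G      ≤⟨ S-average ⟩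
          B * κ          ∎)

    -- 256 = 8² · 2 · 2, from D ≤ 8·(half k)·d̂, pairs T S ≤ 2e and pairs core core ≤ 2Δ.
    greedy-bound : ∀ {Δ D} → degree H v ≤ Δ → 1 ≤ D → D ≤ pairs core core → D ≤ Δ → D ≤ 8 * (half k * dh) →
                   D * D ≤ 256 * inducedEdges H (output ch) * Δ
    greedy-bound {Δ} {D} deg≤Δ 1≤D D≤G D≤Δ D≤8mdh = by-cases (≤-total ∣ core ∣ (half k))
      where
      open ≤-Reasoning
      square-8* : ∀ x → 8 * x * (8 * x) ≡ 64 * (x * x)
      square-8* = solve-∀
      collect-256 : ∀ a b → 64 * (2 * a * (2 * b)) ≡ 256 * a * b
      collect-256 = solve-∀
      e = inducedEdges H (output ch)
      P≤2e : pairs T S ≤ 2 * e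
      P≤2e = pairs-T-S≤2*inducedEdges
      G≤2Δ : pairs core core ≤ 2 * Δ
      G≤2Δ = ≤-trans (pairs≤2*degree core core) (*-monoʳ-≤ 2 deg≤Δ)
      instance
        κ-nonZero : NonZero ∣ core ∣
        κ-nonZero = >-nonZero (positive-square (≤-trans 1≤D (≤-trans D≤G (pairs≤∣X∣*∣Y∣ core core))))
          where
          positive-square : ∀ {a} → 1 ≤ a * a → 1 ≤ a
          positive-square {suc a} _ = s≤s z≤n
      by-cases : ∣ core ∣ ≤ half k ⊎ half k ≤ ∣ core ∣ → D * D ≤ 256 * e * Δ
      by-cases (inj₁ κ≤m) = begin
        D * D        ≤⟨ *-mono-≤ (≤-trans D≤G (≤-trans (small-core κ≤m) P≤2e)) D≤Δ ⟩
        2 * e * Δ    ≤⟨ *-monoˡ-≤ Δ (*-monoˡ-≤ e {2} {256} (s≤s (s≤s z≤n))) ⟩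
        256 * e * Δ  ∎
      by-cases (inj₂ m≤κ) = begin
        D * D                                   ≤⟨ *-mono-≤ D≤8mdh D≤8mdh ⟩
        8 * (half k * dh) * (8 * (half k * dh)) ≡⟨ square-8* (half k * dh) ⟩
        64 * (half k * dh * (half k * dh))      ≤⟨ *-monoʳ-≤ 64 (large-core m≤κ) ⟩
        64 * (pairs T S * pairs core core)      ≤⟨ *-monoʳ-≤ 64 (*-mono-≤ P≤2e G≤2Δ) ⟩
        64 * (2 * e * (2 * Δ))                  ≡⟨ collect-256 e Δ ⟩
        256 * e * Δ                             ∎

  m<[1+m/n]*n : ∀ m n .{{_ : NonZero n}} → m < suc (m / n) * n
  m<[1+m/n]*n m n = begin-strict
    m                  ≡⟨ m≡m%n+[m/n]*n m n ⟩
    m % n + m / n * n  <⟨ +-monoˡ-< (m / n * n) (m%n<n m n) ⟩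
    n + m / n * n      ∎
    where open ≤-Reasoning

  2D≤n²⇒2≤n : ∀ {D n} → 1 ≤ D → 2 * D ≤ n * n → 2 ≤ n
  2D≤n²⇒2≤n {n = zero}        1≤D 2D≤0 = ⊥-elim (<⇒≱ (≤-trans (s≤s z≤n) (*-monoʳ-≤ 2 1≤D)) 2D≤0)
  2D≤n²⇒2≤n {n = suc zero}    1≤D 2D≤1 = ⊥-elim (<⇒≱ (*-monoʳ-≤ 2 1≤D) 2D≤1)
  2D≤n²⇒2≤n {n = suc (suc _)} _   _    = s≤s (s≤s z≤n)

  q*2n≤D∧2D≤n²⇒q<n : ∀ {q D n} → 1 ≤ n → q * (2 * n) ≤ D → 2 * D ≤ n * n → q < n
  q*2n≤D∧2D≤n²⇒q<n {q} {D} {n} 1≤n q*2n≤D 2D≤n² = *-cancelʳ-< (2 * n) q n (begin-strict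
    q * (2 * n)    ≤⟨ q*2n≤D ⟩
    D              ≤⟨ m≤n+m D D ⟩
    D + D          ≡⟨ cong (D +_) (sym (+-identityʳ D)) ⟩
    2 * D          ≤⟨ 2D≤n² ⟩
    n * n          <⟨ *-monoʳ-< n {{>-nonZero 1≤n}} (m<n+m n 1≤n) ⟩
    n * (n + n)    ≡⟨ cong (λ z → n * (n + z)) (sym (+-identityʳ n)) ⟩
    n * (2 * n)    ∎)
    where open ≤-Reasoning

  n≤4*[n/2] : ∀ n → 2 ≤ n → n ≤ 4 * (n / 2)
  n≤4*[n/2] n 2≤n = begin
    n                          ≡⟨ m≡m%n+[m/n]*n n 2 ⟩
    n % 2 + n / 2 * 2          ≤⟨ +-monoˡ-≤ (n / 2 * 2) (≤-trans (≤-pred (m%n<n n 2)) (≤-trans (m≥n⇒m/n>0 2≤n) (m≤m*n (n / 2) 2))) ⟩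
    n / 2 * 2 + n / 2 * 2      ≡⟨ double-double (n / 2) ⟩
    4 * (n / 2)                ∎
    where
    open ≤-Reasoning
    double-double : ∀ a → a * 2 + a * 2 ≡ 4 * a
    double-double = solve-∀

  m<[1+q]*2n⇒m≤8*[n/2*[1+q]] : ∀ {m n q} → 2 ≤ n → m < suc q * (2 * n) → m ≤ 8 * (n / 2 * suc q)
  m<[1+q]*2n⇒m≤8*[n/2*[1+q]] {m} {n} {q} 2≤n m< = begin
    m                             ≤⟨ <⇒≤ m< ⟩
    suc q * (2 * n)               ≤⟨ *-monoʳ-≤ (suc q) (*-monoʳ-≤ 2 (n≤4*[n/2] n 2≤n)) ⟩
    suc q * (2 * (4 * (n / 2)))   ≡⟨ regroup (suc q) (n / 2) ⟩
    8 * (n / 2 * suc q)           ∎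
    where
    open ≤-Reasoning
    regroup : ∀ a b → a * (2 * (4 * b)) ≡ 8 * (b * a)
    regroup = solve-∀

  densest-link-bound : ∀ {n} (H : Hypergraph n) {Δ k : ℕ} → (∀ w → degree H w ≤ Δ) →
                       ∀ {W v} → ∣ W ∣ ≡ k → v ∈ W → 1 ≤ degreeIn H W v →
                       (sel : (v : Fin n) (dh : ℕ) → 1 ≤ dh → dh < k → Choice H k v dh) →
                       ∃[ dh ] Σ (1 ≤ dh) λ p → Σ (dh < k) λ q →
                         degreeIn H W v * degreeIn H W v ≤ 256 * inducedEdges H (output (sel v dh p q)) * Δ
  densest-link-bound H {Δ} {k} deg≤Δ {W} {v} ∣W∣≡k v∈W 1≤D sel =
    suc dd , s≤s z≤n , 1+dd<k , Greedy.greedy-bound ch (deg≤Δ v) 1≤D D≤core D≤Δ D≤8mdh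
    where
    open Link H v
    D = degreeIn H W v
    W₀ = W - v
    k₁ = ∣ W₀ ∣
    k≡1+k₁ : k ≡ suc k₁
    k≡1+k₁ = trans (sym ∣W∣≡k) (∣p∣≡1+∣p-x∣ v∈W)
    2D≤pairs : 2 * D ≤ pairs W₀ W₀
    2D≤pairs = 2*degreeIn≤pairs W
    2D≤k₁² : 2 * D ≤ k₁ * k₁
    2D≤k₁² = ≤-trans 2D≤pairs (pairs≤∣X∣*∣Y∣ W₀ W₀)
    2≤k₁ : 2 ≤ k₁
    2≤k₁ = 2D≤n²⇒2≤n 1≤D 2D≤k₁²
    1≤k₁ : 1 ≤ k₁
    1≤k₁ = ≤-trans (s≤s z≤n) 2≤k₁
    instance
      k₁-nonZero : NonZero k₁
      k₁-nonZero = >-nonZero 1≤k₁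
      2k₁-nonZero : NonZero (2 * k₁)
      2k₁-nonZero = m*n≢0 2 k₁
    dd = D / (2 * k₁)
    dd*2k₁≤D : dd * (2 * k₁) ≤ D
    dd*2k₁≤D = m/n*n≤m D (2 * k₁)
    D<[1+dd]*2k₁ : D < suc dd * (2 * k₁)
    D<[1+dd]*2k₁ = m<[1+m/n]*n D (2 * k₁)
    1+dd<k : suc dd < k
    1+dd<k = subst (suc dd <_) (sym k≡1+k₁) (s≤s (q*2n≤D∧2D≤n²⇒q<n 1≤k₁ dd*2k₁≤D 2D≤k₁²))
    ch = sel v (suc dd) (s≤s z≤n) 1+dd<k
    open Choice ch using (core; peeled)
    D≤core : D ≤ pairs core core
    D≤core = peeled-pairs (λ v∈W₀ → proj₂ (x∈p-y⇒x∈p∧x≢y v∈W₀) refl) (proj₁ peeled) 2D≤pairs dd*2k₁≤D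
    D≤Δ : D ≤ Δ
    D≤Δ = ≤-trans (degreeIn≤degree H W v) (deg≤Δ v)
    D≤8mdh : D ≤ 8 * (half k * suc dd)
    D≤8mdh = subst (λ z → D ≤ 8 * (half z * suc dd)) (sym k≡1+k₁) (m<[1+q]*2n⇒m≤8*[n/2*[1+q]] 2≤k₁ D<[1+dd]*2k₁)

open Combinatorics using (degreeIn; densest-vertex; densest-link-bound)

open import Data.Nat using (ℕ; _≤_; _<_) renaming (_*_ to _*ℕ_)
open import Data.Fin using (Fin)
open import Data.Fin.Subset using (Subset; ∣_∣)
open import Data.Product using (Σ; ∃; ∃-syntax; _×_)
open import Data.Rational using (ℚ; 0ℚ; _*_) renaming (_≤_ to _≤ℚ_; _<_ to _<ℚ_)
open import Relation.Binary.PropositionalEquality using (_≡_)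
open import Data.Nat using (suc; zero; z≤n; s≤s)
open import Data.Nat.Properties using (≤-trans; ≤-reflexive)
open import Data.Product using (_,_; proj₁; proj₂)
open import Data.Empty using (⊥-elim)
open import Data.Integer using (+_; +≤+; +<+)
import Data.Integer as ℤ
import Data.Integer.Properties as ℤ
import Data.Rational as ℚ
import Data.Rational.Properties as ℚ
import Data.Nat.Coprimality as Coprime
open import Data.Rational.Solver using (module +-*-Solver)
open import Relation.Binary.PropositionalEquality using (refl; sym; trans; cong; subst; subst₂)

toℚ≡mkℚ : ∀ m → toℚ m ≡ ℚ.mkℚ (+ m) 0 (Coprime.sym (Coprime.1-coprimeTo m))
toℚ≡mkℚ m = ℚ.normalize-coprime (Coprime.sym (Coprime.1-coprimeTo m))

toℚ-* : ∀ a b → toℚ (a *ℕ b) ≡ toℚ a * toℚ b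
toℚ-* a b rewrite toℚ≡mkℚ a | toℚ≡mkℚ b = cong (ℚ._/ 1) (ℤ.pos-* a b)

toℚ-mono : ∀ {a b} → a ≤ b → toℚ a ≤ℚ toℚ b
toℚ-mono {a} {b} a≤b rewrite toℚ≡mkℚ a | toℚ≡mkℚ b =
  ℚ.*≤* (subst₂ ℤ._≤_ (sym (ℤ.*-identityʳ (+ a))) (sym (ℤ.*-identityʳ (+ b))) (+≤+ a≤b))

toℚ-positive : ∀ {a} → 1 ≤ a → 0ℚ <ℚ toℚ a
toℚ-positive {a} 1≤a rewrite toℚ≡mkℚ a = ℚ.*<* (subst (ℤ._<_ _) (sym (ℤ.*-identityʳ (+ a))) (+<+ 1≤a))

1/256 : ℚ
1/256 = ℚ.normalize 1 256

1/256-positive : 0ℚ <ℚ 1/256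
1/256-positive = ℚ.positive⁻¹ 1/256 {{ℚ.normalize-pos 1 256}}

1/256*256≡1 : 1/256 * toℚ 256 ≡ ℚ.1ℚ
1/256*256≡1 = refl

*-positive : ∀ {p q} → 0ℚ <ℚ p → 0ℚ <ℚ q → 0ℚ <ℚ p * q
*-positive {p} {q} 0<p 0<q = ℚ.positive⁻¹ (p * q) {{ℚ.pos*pos⇒pos p {{ℚ.positive 0<p}} q {{ℚ.positive 0<q}}}}

positive-lower-bound : ∀ {m c d k} → 0ℚ <ℚ c → 0ℚ <ℚ d → 1 ≤ k → c * d * toℚ k ≤ℚ toℚ m → 1 ≤ m
positive-lower-bound {suc _} _   _   _   _   = s≤s z≤n
positive-lower-bound {zero} 0<c 0<d 1≤k cdk≤0 =
  ⊥-elim (ℚ.<-irrefl refl (ℚ.<-≤-trans (*-positive (*-positive 0<c 0<d) (toℚ-positive 1≤k)) cdk≤0))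

squared-bound : ∀ (c d : ℚ) (k D e Δ : ℕ) → 0ℚ <ℚ c → 0ℚ <ℚ d → 1 ≤ k →
                c * d * toℚ k ≤ℚ toℚ (k *ℕ D) → D *ℕ D ≤ 256 *ℕ e *ℕ Δ →
                c * c * 1/256 * d * d ≤ℚ toℚ e * toℚ Δ
squared-bound c d k D e Δ 0<c 0<d 1≤k cdk≤kD D²≤ = begin
  c * c * 1/256 * d * d                    ≡⟨ regroup c d 1/256 ⟩
  1/256 * ((c * d) * (c * d))              ≤⟨ ℚ.*-monoˡ-≤-nonNeg 1/256 {{1/256-nonNeg}} cd²≤D² ⟩
  1/256 * (toℚ D * toℚ D)                  ≡⟨ cong (1/256 *_) (sym (toℚ-* D D)) ⟩
  1/256 * toℚ (D *ℕ D)                     ≤⟨ ℚ.*-monoˡ-≤-nonNeg 1/256 {{1/256-nonNeg}} (toℚ-mono D²≤) ⟩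
  1/256 * toℚ (256 *ℕ e *ℕ Δ)              ≡⟨ cong (1/256 *_) (trans (toℚ-* (256 *ℕ e) Δ) (cong (_* toℚ Δ) (toℚ-* 256 e))) ⟩
  1/256 * ((toℚ 256 * toℚ e) * toℚ Δ)      ≡⟨ regroup′ 1/256 (toℚ 256) (toℚ e) (toℚ Δ) ⟩
  (1/256 * toℚ 256) * (toℚ e * toℚ Δ)      ≡⟨ cong (_* (toℚ e * toℚ Δ)) 1/256*256≡1 ⟩
  ℚ.1ℚ * (toℚ e * toℚ Δ)                   ≡⟨ ℚ.*-identityˡ _ ⟩
  toℚ e * toℚ Δ                            ∎
  where
  open ℚ.≤-Reasoning
  open +-*-Solver
  regroup : ∀ c d r → c * c * r * d * d ≡ r * ((c * d) * (c * d))
  regroup = solve 3 (λ c d r → c :* c :* r :* d :* d := r :* ((c :* d) :* (c :* d))) refl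
  regroup′ : ∀ r a b c → r * ((a * b) * c) ≡ (r * a) * (b * c)
  regroup′ = solve 4 (λ r a b c → r :* ((a :* b) :* c) := (r :* a) :* (b :* c)) refl
  1/256-nonNeg : ℚ.NonNegative 1/256
  1/256-nonNeg = ℚ.nonNegative (ℚ.<⇒≤ 1/256-positive)
  instance
    cd-nonNeg : ℚ.NonNegative (c * d)
    cd-nonNeg = ℚ.nonNegative (ℚ.<⇒≤ (*-positive 0<c 0<d))
    k-pos : ℚ.Positive (toℚ k)
    k-pos = ℚ.positive (toℚ-positive 1≤k)
    D-nonNeg : ℚ.NonNegative (toℚ D)
    D-nonNeg = ℚ.normalize-nonNeg D 1
  cd≤D : c * d ≤ℚ toℚ D
  cd≤D = ℚ.*-cancelʳ-≤-pos (toℚ k) (ℚ.≤-trans cdk≤kD (ℚ.≤-reflexive (trans (toℚ-* k D) (ℚ.*-comm (toℚ k) (toℚ D)))))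
  cd²≤D² : (c * d) * (c * d) ≤ℚ toℚ D * toℚ D
  cd²≤D² = ℚ.≤-trans (ℚ.*-monoʳ-≤-nonNeg (c * d) cd≤D) (ℚ.*-monoˡ-≤-nonNeg (toℚ D) cd≤D)

lemma4 : (c : ℚ) → 0ℚ <ℚ c →
    ∃[ C ] (0ℚ <ℚ C ×
      ((n : ℕ) (H : Hypergraph n) (Δ k : ℕ) (d : ℚ) → 0ℚ <ℚ d →
       (∀ v → degree H v ≤ Δ) →
       1 ≤ k →
       (∃[ W ] (∣ W ∣ ≡ k × c * d * toℚ k ≤ℚ toℚ (3 *ℕ inducedEdges H W))) →
       (sel : (v : Fin n) (dh : ℕ) → 1 ≤ dh → dh < k → Choice H k v dh) →
       ∃[ v ] ∃[ dh ] Σ (1 ≤ dh) λ p → Σ (dh < k) λ q →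
         C * d * d ≤ℚ toℚ (inducedEdges H (output (sel v dh p q))) * toℚ Δ))
lemma4 c 0<c = c * c * 1/256 , C-positive , bound
  where
  1≤3m⇒1≤m : ∀ {m} → 1 ≤ 3 *ℕ m → 1 ≤ m
  1≤3m⇒1≤m {suc _} _ = s≤s z≤n
  C-positive : 0ℚ <ℚ c * c * 1/256
  C-positive = *-positive (*-positive 0<c 0<c) 1/256-positive
  bound : (n : ℕ) (H : Hypergraph n) (Δ k : ℕ) (d : ℚ) → 0ℚ <ℚ d → (∀ v → degree H v ≤ Δ) → 1 ≤ k →
          (∃[ W ] (∣ W ∣ ≡ k × c * d * toℚ k ≤ℚ toℚ (3 *ℕ inducedEdges H W))) →
          (sel : (v : Fin n) (dh : ℕ) → 1 ≤ dh → dh < k → Choice H k v dh) →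
          ∃[ v ] ∃[ dh ] Σ (1 ≤ dh) λ p → Σ (dh < k) λ q →
            c * c * 1/256 * d * d ≤ℚ toℚ (inducedEdges H (output (sel v dh p q))) * toℚ Δ
  bound n H Δ k d 0<d deg≤Δ 1≤k (W , ∣W∣≡k , cdk≤3e) sel =
    v , dh , p , q , squared-bound c d k D (inducedEdges H (output (sel v dh p q))) Δ 0<c 0<d 1≤k cdk≤kD D²≤
    where
    vertex = densest-vertex H W (1≤3m⇒1≤m (positive-lower-bound 0<c 0<d 1≤k cdk≤3e))
    v = proj₁ vertex
    D = degreeIn H W v
    link = densest-link-bound H deg≤Δ ∣W∣≡k (proj₁ (proj₂ vertex)) (proj₁ (proj₂ (proj₂ vertex))) sel
    dh = proj₁ link
    p = proj₁ (proj₂ link)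
    q = proj₁ (proj₂ (proj₂ link))
    D²≤ : D *ℕ D ≤ 256 *ℕ inducedEdges H (output (sel v dh p q)) *ℕ Δ
    D²≤ = proj₂ (proj₂ (proj₂ link))
    cdk≤kD : c * d * toℚ k ≤ℚ toℚ (k *ℕ D)
    cdk≤kD = ℚ.≤-trans cdk≤3e (toℚ-mono (≤-trans (proj₂ (proj₂ (proj₂ vertex))) (≤-reflexive (cong (_*ℕ D) ∣W∣≡k))))
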